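{- Let $L$ be either of the sequent calculi $\mathrm{lTS4}$ or $\mathrm{gTS4}$ defined in the context. Then for every formula $\alpha$, each of the following three sequents is provable in $L$ without using the rule (cut): (1) $\alpha\Rightarrow\alpha$; (2) $\alpha,\neg\alpha\Rightarrow$ ; (3) $\Rightarrow\alpha,\neg\alpha$.
   Context: Formulas are built from countably many propositional variables using the binary connectives $\wedge,\vee,\to$ and the unary connectives $\neg,\Box,\Diamond$. Letters $\Gamma,\Delta$ (possibly with subscripts) denote finite, possibly empty, sets of formulas; a sequent is an expression $\Gamma\Rightarrow\Delta$; a comma denotes union (e.g. $\alpha,\Gamma$ is $\{\alpha\}\cup\Gamma$). For a word $w$ over $\{\neg,\Box,\Diamond\}$, $w\Gamma=\{w\gamma:\gamma\in\Gamma\}$. A rule "$S_1;\dots;S_n\,/\,S$" has premises $S_1,\dots,S_n$ and conclusion $S$. "Cut-free $L$" means the system $L$ with the rule (cut) removed. The calculus lTS4. Initial sequents: for every propositional variable $p$: $p\Rightarrow p$, $\neg p\Rightarrow\neg p$, $\neg p,p\Rightarrow$, and $\Rightarrow\neg p,p$. Structural rules: (cut) $\Gamma\Rightarrow\alpha$; $\alpha,\Gamma\Rightarrow\Delta$ / $\Gamma\Rightarrow\Delta$. (we-left) $\Gamma\Rightarrow\Delta$ / $\alpha,\Gamma\Rightarrow\Delta$. (we-right) $\Gamma\Rightarrow\Delta$ / $\Gamma\Rightarrow\Delta,\alpha$. Non-twist logical rules: ($\wedge$left) $\alpha,\beta,\Gamma\Rightarrow\Delta$ / $\alpha\wedge\beta,\Gamma\Rightarrow\Delta$.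 ($\wedge$right) $\Gamma\Rightarrow\Delta,\alpha$; $\Gamma\Rightarrow\Delta,\beta$ / $\Gamma\Rightarrow\Delta,\alpha\wedge\beta$. ($\vee$left) $\alpha,\Gamma\Rightarrow\Delta$; $\beta,\Gamma\Rightarrow\Delta$ / $\alpha\vee\beta,\Gamma\Rightarrow\Delta$. ($\vee$right) $\Gamma\Rightarrow\Delta,\alpha,\beta$ / $\Gamma\Rightarrow\Delta,\alpha\vee\beta$. ($\to$left) $\Gamma\Rightarrow\Delta,\alpha$; $\beta,\Gamma\Rightarrow\Delta$ / $\alpha\to\beta,\Gamma\Rightarrow\Delta$. ($\to$right) $\alpha,\Gamma\Rightarrow\Delta,\beta$ / $\Gamma\Rightarrow\Delta,\alpha\to\beta$. ($\Box$left) $\alpha,\Gamma\Rightarrow\Delta$ / $\Box\alpha,\Gamma\Rightarrow\Delta$. ($\Box$right) $\Box\Gamma_1,\neg\Diamond\Gamma_2\Rightarrow\Diamond\Delta_1,\neg\Box\Delta_2,\alpha$ / $\Box\Gamma_1,\neg\Diamond\Gamma_2\Rightarrow\Diamond\Delta_1,\neg\Box\Delta_2,\Box\alpha$. ($\Diamond$left) $\alpha,\Box\Gamma_1,\neg\Diamond\Gamma_2\Rightarrow\Diamond\Delta_1,\neg\Box\Delta_2$ / $\Diamond\alpha,\Box\Gamma_1,\neg\Diamond\Gamma_2\Rightarrow\Diamond\Delta_1,\neg\Box\Delta_2$. ($\Diamond$right) $\Gamma\Rightarrow\Delta,\alpha$ / $\Gamma\Rightarrow\Delta,\Diamond\alpha$.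 Twist rules: ($\neg\neg$left$^t$) $\alpha,\Gamma\Rightarrow\Delta$ / $\neg\neg\alpha,\Gamma\Rightarrow\Delta$. ($\neg\neg$right$^t$) $\Gamma\Rightarrow\Delta,\alpha$ / $\Gamma\Rightarrow\Delta,\neg\neg\alpha$. ($\neg\wedge$left$^t$) $\Gamma\Rightarrow\Delta,\alpha$; $\Gamma\Rightarrow\Delta,\beta$ / $\neg(\alpha\wedge\beta),\Gamma\Rightarrow\Delta$. ($\neg\wedge$right$^t$) $\alpha,\beta,\Gamma\Rightarrow\Delta$ / $\Gamma\Rightarrow\Delta,\neg(\alpha\wedge\beta)$. ($\neg\vee$left$^t$) $\Gamma\Rightarrow\Delta,\alpha,\beta$ / $\neg(\alpha\vee\beta),\Gamma\Rightarrow\Delta$. ($\neg\vee$right$^t$) $\alpha,\Gamma\Rightarrow\Delta$; $\beta,\Gamma\Rightarrow\Delta$ / $\Gamma\Rightarrow\Delta,\neg(\alpha\vee\beta)$. ($\neg\to$left$^t$) $\alpha,\Gamma\Rightarrow\Delta,\beta$ / $\neg(\alpha\to\beta),\Gamma\Rightarrow\Delta$. ($\neg\to$right$^t$) $\Gamma\Rightarrow\Delta,\alpha$; $\beta,\Gamma\Rightarrow\Delta$ / $\Gamma\Rightarrow\Delta,\neg(\alpha\to\beta)$. ($\neg\Box$left$^t$) $\Box\Gamma_1,\neg\Diamond\Gamma_2\Rightarrow\Diamond\Delta_1,\neg\Box\Delta_2,\alpha$ / $\neg\Box\alpha,\Box\Gamma_1,\neg\Diamond\Gamma_2\Rightarrow\Diamond\Delta_1,\neg\Box\Delta_2$.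 ($\neg\Box$right$^t$) $\alpha,\Gamma\Rightarrow\Delta$ / $\Gamma\Rightarrow\Delta,\neg\Box\alpha$. ($\neg\Diamond$left$^t$) $\Gamma\Rightarrow\Delta,\alpha$ / $\neg\Diamond\alpha,\Gamma\Rightarrow\Delta$. ($\neg\Diamond$right$^t$) $\alpha,\Box\Gamma_1,\neg\Diamond\Gamma_2\Rightarrow\Diamond\Delta_1,\neg\Box\Delta_2$ / $\Box\Gamma_1,\neg\Diamond\Gamma_2\Rightarrow\Diamond\Delta_1,\neg\Box\Delta_2,\neg\Diamond\alpha$. The calculus gTS4 is obtained from lTS4 by replacing ($\Box$right), ($\Diamond$left), ($\neg\Box$left$^t$), ($\neg\Diamond$right$^t$) with: ($\Box$right$^T$) $\Box\Gamma_1,\Box\Delta_2\Rightarrow\Diamond\Delta_1,\Diamond\Gamma_2,\alpha$ / $\Box\Gamma_1,\neg\Diamond\Gamma_2\Rightarrow\Diamond\Delta_1,\neg\Box\Delta_2,\Box\alpha$. ($\Diamond$left$^T$) $\alpha,\Box\Gamma_1,\Box\Delta_2\Rightarrow\Diamond\Delta_1,\Diamond\Gamma_2$ / $\Diamond\alpha,\Box\Gamma_1,\neg\Diamond\Gamma_2\Rightarrow\Diamond\Delta_1,\neg\Box\Delta_2$. ($\neg\Box$left$^T$) $\Box\Gamma_1,\Box\Delta_2\Rightarrow\Diamond\Delta_1,\Diamond\Gamma_2,\alpha$ / $\neg\Box\alpha,\Box\Gamma_1,\neg\Diamond\Gamma_2\Rightarrow\Diamond\Delta_1,\neg\Box\Delta_2$.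 ($\neg\Diamond$right$^T$) $\alpha,\Box\Gamma_1,\Box\Delta_2\Rightarrow\Diamond\Delta_1,\Diamond\Gamma_2$ / $\Box\Gamma_1,\neg\Diamond\Gamma_2\Rightarrow\Diamond\Delta_1,\neg\Box\Delta_2,\neg\Diamond\alpha$. (All other rules and initial sequents of lTS4, including ($\neg\Diamond$left$^t$), are kept.) -}

module Defs where

open import Data.Nat using (ℕ)
open import Data.Bool using (Bool; true; false)
open import Data.List using (List; []; _∷_; _++_; map)
open import Data.List.Membership.Propositional using (_∈_)
open import Function.Bundles using (_⇔_)
open import Relation.Binary.PropositionalEquality using () renaming (_≡_ to _≡'_)

infixr 8 _∧_
infixr 7 _∨_
infixr 6 _⇒_

data Fm : Set where
  var : ℕ → Fm
  _∧_ _∨_ _⇒_ : Fm → Fm → Fm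
  ¬_ □_ ◇_ : Fm → Fm

infix 10 ¬_ □_ ◇_

-- Finite sets of formulas are represented by lists, identified up to
-- having the same elements (see the rule `set-eq` below).
SameSet : List Fm → List Fm → Set
SameSet Γ Γ' = ∀ φ → (φ ∈ Γ) ⇔ (φ ∈ Γ')

data Calc : Set where
  lTS4 gTS4 : Calc

-- Derivability  L ∣ c ⊢ Γ ⟹ Δ ; c = true allows (cut), c = false is cut-free L.
infix 3 _∣_⊢_⟹_
data _∣_⊢_⟹_ (L : Calc) : Bool → List Fm → List Fm → Set where
  set-eq : ∀ {c Γ Δ Γ' Δ'} → SameSet Γ Γ' → SameSet Δ Δ' →
           L ∣ c ⊢ Γ ⟹ Δ → L ∣ c ⊢ Γ' ⟹ Δ'
  ax1 : ∀ {c} p → L ∣ c ⊢ var p ∷ [] ⟹ var p ∷ []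
  ax2 : ∀ {c} p → L ∣ c ⊢ ¬ var p ∷ [] ⟹ ¬ var p ∷ []
  ax3 : ∀ {c} p → L ∣ c ⊢ ¬ var p ∷ var p ∷ [] ⟹ []
  ax4 : ∀ {c} p → L ∣ c ⊢ [] ⟹ ¬ var p ∷ var p ∷ []
  cut : ∀ {Γ Δ} α → L ∣ true ⊢ Γ ⟹ α ∷ [] → L ∣ true ⊢ α ∷ Γ ⟹ Δ → L ∣ true ⊢ Γ ⟹ Δ
  we-left : ∀ {c Γ Δ} α → L ∣ c ⊢ Γ ⟹ Δ → L ∣ c ⊢ α ∷ Γ ⟹ Δ
  we-right : ∀ {c Γ Δ} α → L ∣ c ⊢ Γ ⟹ Δ → L ∣ c ⊢ Γ ⟹ α ∷ Δ
  ∧left : ∀ {c Γ Δ α β} → L ∣ c ⊢ α ∷ β ∷ Γ ⟹ Δ → L ∣ c ⊢ α ∧ β ∷ Γ ⟹ Δ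
  ∧right : ∀ {c Γ Δ α β} → L ∣ c ⊢ Γ ⟹ α ∷ Δ → L ∣ c ⊢ Γ ⟹ β ∷ Δ → L ∣ c ⊢ Γ ⟹ α ∧ β ∷ Δ
  ∨left : ∀ {c Γ Δ α β} → L ∣ c ⊢ α ∷ Γ ⟹ Δ → L ∣ c ⊢ β ∷ Γ ⟹ Δ → L ∣ c ⊢ α ∨ β ∷ Γ ⟹ Δ
  ∨right : ∀ {c Γ Δ α β} → L ∣ c ⊢ Γ ⟹ α ∷ β ∷ Δ → L ∣ c ⊢ Γ ⟹ α ∨ β ∷ Δ
  ⇒left : ∀ {c Γ Δ α β} → L ∣ c ⊢ Γ ⟹ α ∷ Δ → L ∣ c ⊢ β ∷ Γ ⟹ Δ → L ∣ c ⊢ α ⇒ β ∷ Γ ⟹ Δ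
  ⇒right : ∀ {c Γ Δ α β} → L ∣ c ⊢ α ∷ Γ ⟹ β ∷ Δ → L ∣ c ⊢ Γ ⟹ α ⇒ β ∷ Δ
  □left : ∀ {c Γ Δ α} → L ∣ c ⊢ α ∷ Γ ⟹ Δ → L ∣ c ⊢ □ α ∷ Γ ⟹ Δ
  ◇right : ∀ {c Γ Δ α} → L ∣ c ⊢ Γ ⟹ α ∷ Δ → L ∣ c ⊢ Γ ⟹ ◇ α ∷ Δ
  □right : ∀ {c Γ₁ Γ₂ Δ₁ Δ₂ α} → L ≡' lTS4 →
    L ∣ c ⊢ map □_ Γ₁ ++ map (λ x → ¬ ◇ x) Γ₂ ⟹ α ∷ map ◇_ Δ₁ ++ map (λ x → ¬ □ x) Δ₂ →
    L ∣ c ⊢ map □_ Γ₁ ++ map (λ x → ¬ ◇ x) Γ₂ ⟹ □ α ∷ map ◇_ Δ₁ ++ map (λ x → ¬ □ x) Δ₂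
  ◇left : ∀ {c Γ₁ Γ₂ Δ₁ Δ₂ α} → L ≡' lTS4 →
    L ∣ c ⊢ α ∷ map □_ Γ₁ ++ map (λ x → ¬ ◇ x) Γ₂ ⟹ map ◇_ Δ₁ ++ map (λ x → ¬ □ x) Δ₂ →
    L ∣ c ⊢ ◇ α ∷ map □_ Γ₁ ++ map (λ x → ¬ ◇ x) Γ₂ ⟹ map ◇_ Δ₁ ++ map (λ x → ¬ □ x) Δ₂
  ¬□left-t : ∀ {c Γ₁ Γ₂ Δ₁ Δ₂ α} → L ≡' lTS4 →
    L ∣ c ⊢ map □_ Γ₁ ++ map (λ x → ¬ ◇ x) Γ₂ ⟹ α ∷ map ◇_ Δ₁ ++ map (λ x → ¬ □ x) Δ₂ →
    L ∣ c ⊢ ¬ □ α ∷ map □_ Γ₁ ++ map (λ x → ¬ ◇ x) Γ₂ ⟹ map ◇_ Δ₁ ++ map (λ x → ¬ □ x) Δ₂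
  ¬◇right-t : ∀ {c Γ₁ Γ₂ Δ₁ Δ₂ α} → L ≡' lTS4 →
    L ∣ c ⊢ α ∷ map □_ Γ₁ ++ map (λ x → ¬ ◇ x) Γ₂ ⟹ map ◇_ Δ₁ ++ map (λ x → ¬ □ x) Δ₂ →
    L ∣ c ⊢ map □_ Γ₁ ++ map (λ x → ¬ ◇ x) Γ₂ ⟹ ¬ ◇ α ∷ map ◇_ Δ₁ ++ map (λ x → ¬ □ x) Δ₂
  □right-T : ∀ {c Γ₁ Γ₂ Δ₁ Δ₂ α} → L ≡' gTS4 →
    L ∣ c ⊢ map □_ Γ₁ ++ map □_ Δ₂ ⟹ α ∷ map ◇_ Δ₁ ++ map ◇_ Γ₂ →
    L ∣ c ⊢ map □_ Γ₁ ++ map (λ x → ¬ ◇ x) Γ₂ ⟹ □ α ∷ map ◇_ Δ₁ ++ map (λ x → ¬ □ x) Δ₂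
  ◇left-T : ∀ {c Γ₁ Γ₂ Δ₁ Δ₂ α} → L ≡' gTS4 →
    L ∣ c ⊢ α ∷ map □_ Γ₁ ++ map □_ Δ₂ ⟹ map ◇_ Δ₁ ++ map ◇_ Γ₂ →
    L ∣ c ⊢ ◇ α ∷ map □_ Γ₁ ++ map (λ x → ¬ ◇ x) Γ₂ ⟹ map ◇_ Δ₁ ++ map (λ x → ¬ □ x) Δ₂
  ¬□left-T : ∀ {c Γ₁ Γ₂ Δ₁ Δ₂ α} → L ≡' gTS4 →
    L ∣ c ⊢ map □_ Γ₁ ++ map □_ Δ₂ ⟹ α ∷ map ◇_ Δ₁ ++ map ◇_ Γ₂ →
    L ∣ c ⊢ ¬ □ α ∷ map □_ Γ₁ ++ map (λ x → ¬ ◇ x) Γ₂ ⟹ map ◇_ Δ₁ ++ map (λ x → ¬ □ x) Δ₂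
  ¬◇right-T : ∀ {c Γ₁ Γ₂ Δ₁ Δ₂ α} → L ≡' gTS4 →
    L ∣ c ⊢ α ∷ map □_ Γ₁ ++ map □_ Δ₂ ⟹ map ◇_ Δ₁ ++ map ◇_ Γ₂ →
    L ∣ c ⊢ map □_ Γ₁ ++ map (λ x → ¬ ◇ x) Γ₂ ⟹ ¬ ◇ α ∷ map ◇_ Δ₁ ++ map (λ x → ¬ □ x) Δ₂
  ¬¬left : ∀ {c Γ Δ α} → L ∣ c ⊢ α ∷ Γ ⟹ Δ → L ∣ c ⊢ ¬ ¬ α ∷ Γ ⟹ Δ
  ¬¬right : ∀ {c Γ Δ α} → L ∣ c ⊢ Γ ⟹ α ∷ Δ → L ∣ c ⊢ Γ ⟹ ¬ ¬ α ∷ Δ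
  ¬∧left : ∀ {c Γ Δ α β} → L ∣ c ⊢ Γ ⟹ α ∷ Δ → L ∣ c ⊢ Γ ⟹ β ∷ Δ → L ∣ c ⊢ ¬ (α ∧ β) ∷ Γ ⟹ Δ
  ¬∧right : ∀ {c Γ Δ α β} → L ∣ c ⊢ α ∷ β ∷ Γ ⟹ Δ → L ∣ c ⊢ Γ ⟹ ¬ (α ∧ β) ∷ Δ
  ¬∨left : ∀ {c Γ Δ α β} → L ∣ c ⊢ Γ ⟹ α ∷ β ∷ Δ → L ∣ c ⊢ ¬ (α ∨ β) ∷ Γ ⟹ Δ
  ¬∨right : ∀ {c Γ Δ α β} → L ∣ c ⊢ α ∷ Γ ⟹ Δ → L ∣ c ⊢ β ∷ Γ ⟹ Δ → L ∣ c ⊢ Γ ⟹ ¬ (α ∨ β) ∷ Δ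
  ¬⇒left : ∀ {c Γ Δ α β} → L ∣ c ⊢ α ∷ Γ ⟹ β ∷ Δ → L ∣ c ⊢ ¬ (α ⇒ β) ∷ Γ ⟹ Δ
  ¬⇒right : ∀ {c Γ Δ α β} → L ∣ c ⊢ Γ ⟹ α ∷ Δ → L ∣ c ⊢ β ∷ Γ ⟹ Δ → L ∣ c ⊢ Γ ⟹ ¬ (α ⇒ β) ∷ Δ
  ¬□right : ∀ {c Γ Δ α} → L ∣ c ⊢ α ∷ Γ ⟹ Δ → L ∣ c ⊢ Γ ⟹ ¬ □ α ∷ Δ
  ¬◇left : ∀ {c Γ Δ α} → L ∣ c ⊢ Γ ⟹ α ∷ Δ → L ∣ c ⊢ ¬ ◇ α ∷ Γ ⟹ Δ

-- For a ★ b, the left and right rules for ★ and the twist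
-- rules for ¬★ mirror each other, so the four sequents a ★ b ⇒ a ★ b,
-- ¬(a ★ b) ⇒ ¬(a ★ b), a ★ b, ¬(a ★ b) ⇒ and ⇒ a ★ b, ¬(a ★ b) are all
-- assembled from the same few sequents over the identities a ⇒ a and b ⇒ b
-- (likewise for □, ◇); double negations are peeled off by the ¬¬ rules.
module Submission where

open import Defs
open import Data.Bool using (Bool; false)
open import Data.List using ([]; _∷_)
open import Data.List.Relation.Binary.Permutation.Propositional using (_↭_; ↭-refl; ↭-swap; ↭-sym)
open import Data.List.Relation.Binary.Permutation.Propositional.Properties using (∈-resp-↭; shift)
open import Data.Product using (_×_; _,_)
open import Function.Bundles using (mk⇔)
open import Relation.Binary.PropositionalEquality using (refl)

↭⇒SameSet : ∀ {Γ Γ'} → Γ ↭ Γ' → SameSet Γ Γ'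
↭⇒SameSet Γ↭Γ' φ = mk⇔ (∈-resp-↭ Γ↭Γ') (∈-resp-↭ (↭-sym Γ↭Γ'))

module _ {L : Calc} {c : Bool} where

  exchangeˡ : ∀ {Γ Γ' Δ} → Γ ↭ Γ' → L ∣ c ⊢ Γ ⟹ Δ → L ∣ c ⊢ Γ' ⟹ Δ
  exchangeˡ Γ↭Γ' = set-eq (↭⇒SameSet Γ↭Γ') (↭⇒SameSet ↭-refl)

  exchangeʳ : ∀ {Γ Δ Δ'} → Δ ↭ Δ' → L ∣ c ⊢ Γ ⟹ Δ → L ∣ c ⊢ Γ ⟹ Δ'
  exchangeʳ Δ↭Δ' = set-eq (↭⇒SameSet ↭-refl) (↭⇒SameSet Δ↭Δ')

  swapˡ : ∀ {α β Γ Δ} → L ∣ c ⊢ α ∷ β ∷ Γ ⟹ Δ → L ∣ c ⊢ β ∷ α ∷ Γ ⟹ Δ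
  swapˡ = exchangeˡ (↭-swap _ _ ↭-refl)

  swapʳ : ∀ {Γ α β Δ} → L ∣ c ⊢ Γ ⟹ α ∷ β ∷ Δ → L ∣ c ⊢ Γ ⟹ β ∷ α ∷ Δ
  swapʳ = exchangeʳ (↭-swap _ _ ↭-refl)

  rotateˡ : ∀ {α β γ Γ Δ} → L ∣ c ⊢ α ∷ β ∷ γ ∷ Γ ⟹ Δ → L ∣ c ⊢ β ∷ γ ∷ α ∷ Γ ⟹ Δ
  rotateˡ = exchangeˡ (↭-sym (shift _ (_ ∷ _ ∷ []) _))

  rotateʳ : ∀ {Γ α β γ Δ} → L ∣ c ⊢ Γ ⟹ α ∷ β ∷ γ ∷ Δ → L ∣ c ⊢ Γ ⟹ β ∷ γ ∷ α ∷ Δ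
  rotateʳ = exchangeʳ (↭-sym (shift _ (_ ∷ _ ∷ []) _))

  we-left₂ : ∀ {α Γ Δ} β → L ∣ c ⊢ α ∷ Γ ⟹ Δ → L ∣ c ⊢ α ∷ β ∷ Γ ⟹ Δ
  we-left₂ β d = swapˡ (we-left β d)

  we-right₂ : ∀ {Γ α Δ} β → L ∣ c ⊢ Γ ⟹ α ∷ Δ → L ∣ c ⊢ Γ ⟹ α ∷ β ∷ Δ
  we-right₂ β d = swapʳ (we-right β d)

module _ {L : Calc} {c : Bool} {a b : Fm}
         (ia : L ∣ c ⊢ a ∷ [] ⟹ a ∷ []) (ib : L ∣ c ⊢ b ∷ [] ⟹ b ∷ []) where

  private
    π₁ : L ∣ c ⊢ a ∷ b ∷ [] ⟹ a ∷ []
    π₁ = we-left₂ b ia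

    π₂ : L ∣ c ⊢ a ∷ b ∷ [] ⟹ b ∷ []
    π₂ = we-left a ib

    ι₁ : L ∣ c ⊢ a ∷ [] ⟹ a ∷ b ∷ []
    ι₁ = we-right₂ b ia

    ι₂ : L ∣ c ⊢ b ∷ [] ⟹ a ∷ b ∷ []
    ι₂ = we-right a ib

    ¬∧-refutes : L ∣ c ⊢ a ∷ b ∷ ¬ (a ∧ b) ∷ [] ⟹ []
    ¬∧-refutes = rotateˡ (¬∧left π₁ π₂)

    ¬∨-refutesˡ : L ∣ c ⊢ a ∷ ¬ (a ∨ b) ∷ [] ⟹ []
    ¬∨-refutesˡ = swapˡ (¬∨left ι₁)

    ¬∨-refutesʳ : L ∣ c ⊢ b ∷ ¬ (a ∨ b) ∷ [] ⟹ []
    ¬∨-refutesʳ = swapˡ (¬∨left ι₂)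

    ¬⇒-antecedent : L ∣ c ⊢ ¬ (a ⇒ b) ∷ [] ⟹ a ∷ []
    ¬⇒-antecedent = ¬⇒left (we-right b ia)

    ¬⇒-consequent : L ∣ c ⊢ b ∷ ¬ (a ⇒ b) ∷ [] ⟹ []
    ¬⇒-consequent = swapˡ (¬⇒left π₂)

  ∧-identity : L ∣ c ⊢ a ∧ b ∷ [] ⟹ a ∧ b ∷ []
  ∧-identity = ∧left (∧right π₁ π₂)

  ¬∧-identity : L ∣ c ⊢ ¬ (a ∧ b) ∷ [] ⟹ ¬ (a ∧ b) ∷ []
  ¬∧-identity = ¬∧right ¬∧-refutes

  ∧-noncontradiction : L ∣ c ⊢ a ∧ b ∷ ¬ (a ∧ b) ∷ [] ⟹ []
  ∧-noncontradiction = ∧left ¬∧-refutes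

  ∧-excludedMiddle : L ∣ c ⊢ [] ⟹ a ∧ b ∷ ¬ (a ∧ b) ∷ []
  ∧-excludedMiddle = ∧right (swapʳ (¬∧right π₁)) (swapʳ (¬∧right π₂))

  ∨-identity : L ∣ c ⊢ a ∨ b ∷ [] ⟹ a ∨ b ∷ []
  ∨-identity = ∨left (∨right ι₁) (∨right ι₂)

  ¬∨-identity : L ∣ c ⊢ ¬ (a ∨ b) ∷ [] ⟹ ¬ (a ∨ b) ∷ []
  ¬∨-identity = ¬∨right ¬∨-refutesˡ ¬∨-refutesʳ

  ∨-noncontradiction : L ∣ c ⊢ a ∨ b ∷ ¬ (a ∨ b) ∷ [] ⟹ []
  ∨-noncontradiction = ∨left ¬∨-refutesˡ ¬∨-refutesʳ

  ∨-excludedMiddle : L ∣ c ⊢ [] ⟹ a ∨ b ∷ ¬ (a ∨ b) ∷ []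
  ∨-excludedMiddle = ∨right (rotateʳ (¬∨right ι₁ ι₂))

  ⇒-identity : L ∣ c ⊢ a ⇒ b ∷ [] ⟹ a ⇒ b ∷ []
  ⇒-identity = ⇒right (swapˡ (⇒left ι₁ (we-left₂ a ib)))

  ¬⇒-identity : L ∣ c ⊢ ¬ (a ⇒ b) ∷ [] ⟹ ¬ (a ⇒ b) ∷ []
  ¬⇒-identity = ¬⇒right ¬⇒-antecedent ¬⇒-consequent

  ⇒-noncontradiction : L ∣ c ⊢ a ⇒ b ∷ ¬ (a ⇒ b) ∷ [] ⟹ []
  ⇒-noncontradiction = ⇒left ¬⇒-antecedent ¬⇒-consequent

  ⇒-excludedMiddle : L ∣ c ⊢ [] ⟹ a ⇒ b ∷ ¬ (a ⇒ b) ∷ []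
  ⇒-excludedMiddle = ⇒right (swapʳ (¬⇒right ι₁ (we-left₂ a ib)))

-- In gTS4 the premise of a modal rule turns the side formulas ¬◇γ and ¬□δ into
-- □δ and ◇γ on the other side, so each gTS4 case closes by (□left) or (◇right).
module _ {c : Bool} {a : Fm} where

  □-identity : ∀ L → L ∣ c ⊢ a ∷ [] ⟹ a ∷ [] → L ∣ c ⊢ □ a ∷ [] ⟹ □ a ∷ []
  □-identity lTS4 ia = □right {Γ₁ = a ∷ []} {Γ₂ = []} {Δ₁ = []} {Δ₂ = []} refl (□left ia)
  □-identity gTS4 ia = □right-T {Γ₁ = a ∷ []} {Γ₂ = []} {Δ₁ = []} {Δ₂ = []} refl (□left ia)

  ¬□-identity : ∀ L → L ∣ c ⊢ a ∷ [] ⟹ a ∷ [] → L ∣ c ⊢ ¬ □ a ∷ [] ⟹ ¬ □ a ∷ []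
  ¬□-identity lTS4 ia = ¬□left-t {Γ₁ = []} {Γ₂ = []} {Δ₁ = []} {Δ₂ = a ∷ []} refl (swapʳ (¬□right ia))
  ¬□-identity gTS4 ia = ¬□left-T {Γ₁ = []} {Γ₂ = []} {Δ₁ = []} {Δ₂ = a ∷ []} refl (□left ia)

  □-noncontradiction : ∀ L → L ∣ c ⊢ a ∷ [] ⟹ a ∷ [] → L ∣ c ⊢ □ a ∷ ¬ □ a ∷ [] ⟹ []
  □-noncontradiction lTS4 ia = swapˡ (¬□left-t {Γ₁ = a ∷ []} {Γ₂ = []} {Δ₁ = []} {Δ₂ = []} refl (□left ia))
  □-noncontradiction gTS4 ia = swapˡ (¬□left-T {Γ₁ = a ∷ []} {Γ₂ = []} {Δ₁ = []} {Δ₂ = []} refl (□left ia))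

  □-excludedMiddle : ∀ L → L ∣ c ⊢ a ∷ [] ⟹ a ∷ [] → L ∣ c ⊢ [] ⟹ □ a ∷ ¬ □ a ∷ []
  □-excludedMiddle lTS4 ia = □right {Γ₁ = []} {Γ₂ = []} {Δ₁ = []} {Δ₂ = a ∷ []} refl (swapʳ (¬□right ia))
  □-excludedMiddle gTS4 ia = □right-T {Γ₁ = []} {Γ₂ = []} {Δ₁ = []} {Δ₂ = a ∷ []} refl (□left ia)

  ◇-identity : ∀ L → L ∣ c ⊢ a ∷ [] ⟹ a ∷ [] → L ∣ c ⊢ ◇ a ∷ [] ⟹ ◇ a ∷ []
  ◇-identity lTS4 ia = ◇left {Γ₁ = []} {Γ₂ = []} {Δ₁ = a ∷ []} {Δ₂ = []} refl (◇right ia)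
  ◇-identity gTS4 ia = ◇left-T {Γ₁ = []} {Γ₂ = []} {Δ₁ = a ∷ []} {Δ₂ = []} refl (◇right ia)

  ¬◇-identity : ∀ L → L ∣ c ⊢ a ∷ [] ⟹ a ∷ [] → L ∣ c ⊢ ¬ ◇ a ∷ [] ⟹ ¬ ◇ a ∷ []
  ¬◇-identity lTS4 ia = ¬◇right-t {Γ₁ = []} {Γ₂ = a ∷ []} {Δ₁ = []} {Δ₂ = []} refl (swapˡ (¬◇left ia))
  ¬◇-identity gTS4 ia = ¬◇right-T {Γ₁ = []} {Γ₂ = a ∷ []} {Δ₁ = []} {Δ₂ = []} refl (◇right ia)

  ◇-noncontradiction : ∀ L → L ∣ c ⊢ a ∷ [] ⟹ a ∷ [] → L ∣ c ⊢ ◇ a ∷ ¬ ◇ a ∷ [] ⟹ []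
  ◇-noncontradiction lTS4 ia = ◇left {Γ₁ = []} {Γ₂ = a ∷ []} {Δ₁ = []} {Δ₂ = []} refl (swapˡ (¬◇left ia))
  ◇-noncontradiction gTS4 ia = ◇left-T {Γ₁ = []} {Γ₂ = a ∷ []} {Δ₁ = []} {Δ₂ = []} refl (◇right ia)

  ◇-excludedMiddle : ∀ L → L ∣ c ⊢ a ∷ [] ⟹ a ∷ [] → L ∣ c ⊢ [] ⟹ ◇ a ∷ ¬ ◇ a ∷ []
  ◇-excludedMiddle lTS4 ia = swapʳ (¬◇right-t {Γ₁ = []} {Γ₂ = []} {Δ₁ = a ∷ []} {Δ₂ = []} refl (◇right ia))
  ◇-excludedMiddle gTS4 ia = swapʳ (¬◇right-T {Γ₁ = []} {Γ₂ = []} {Δ₁ = a ∷ []} {Δ₂ = []} refl (◇right ia))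

module _ (L : Calc) {c : Bool} where

  identity : ∀ α → L ∣ c ⊢ α ∷ [] ⟹ α ∷ []
  identity (var p)       = ax1 p
  identity (a ∧ b)       = ∧-identity (identity a) (identity b)
  identity (a ∨ b)       = ∨-identity (identity a) (identity b)
  identity (a ⇒ b)       = ⇒-identity (identity a) (identity b)
  identity (□ a)         = □-identity L (identity a)
  identity (◇ a)         = ◇-identity L (identity a)
  identity (¬ var p)     = ax2 p
  identity (¬ (a ∧ b))   = ¬∧-identity (identity a) (identity b)
  identity (¬ (a ∨ b))   = ¬∨-identity (identity a) (identity b)
  identity (¬ (a ⇒ b))   = ¬⇒-identity (identity a) (identity b)
  identity (¬ ¬ a)       = ¬¬left (¬¬right (identity a))
  identity (¬ □ a)       = ¬□-identity L (identity a)
  identity (¬ ◇ a)       = ¬◇-identity L (identity a)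

  noncontradiction : ∀ α → L ∣ c ⊢ α ∷ ¬ α ∷ [] ⟹ []
  noncontradiction (var p) = swapˡ (ax3 p)
  noncontradiction (a ∧ b) = ∧-noncontradiction (identity a) (identity b)
  noncontradiction (a ∨ b) = ∨-noncontradiction (identity a) (identity b)
  noncontradiction (a ⇒ b) = ⇒-noncontradiction (identity a) (identity b)
  noncontradiction (□ a)   = □-noncontradiction L (identity a)
  noncontradiction (◇ a)   = ◇-noncontradiction L (identity a)
  noncontradiction (¬ a)   = swapˡ (¬¬left (noncontradiction a))

  excludedMiddle : ∀ α → L ∣ c ⊢ [] ⟹ α ∷ ¬ α ∷ []
  excludedMiddle (var p) = swapʳ (ax4 p)
  excludedMiddle (a ∧ b) = ∧-excludedMiddle (identity a) (identity b)
  excludedMiddle (a ∨ b) = ∨-excludedMiddle (identity a) (identity b)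
  excludedMiddle (a ⇒ b) = ⇒-excludedMiddle (identity a) (identity b)
  excludedMiddle (□ a)   = □-excludedMiddle L (identity a)
  excludedMiddle (◇ a)   = ◇-excludedMiddle L (identity a)
  excludedMiddle (¬ a)   = swapʳ (¬¬right (excludedMiddle a))

proposition2p5 : (L : Calc) (α : Fm) →
    (L ∣ false ⊢ α ∷ [] ⟹ α ∷ [])
    × (L ∣ false ⊢ α ∷ ¬ α ∷ [] ⟹ [])
    × (L ∣ false ⊢ [] ⟹ α ∷ ¬ α ∷ [])
proposition2p5 L α = identity L α , noncontradiction L α , excludedMiddle L α
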